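{- Let $\mathcal{L}=(\mathcal{B},\emptyset,\_)$ be a language with an arbitrary set $\mathcal{B}$ of base types and no constants. Assume $\Gamma\vdash_{\mathcal{L}} t : T$. Then there exist a type $M$ and terms $l,r$ with $\Gamma\vdash l : M$ and $(x:M)\vdash r : T$ such that (i) for every polarity $p\in\{+,-\}$, $M^p\subseteq \Gamma^p\cap T^p$; (ii) $\Gamma\vdash t\equiv r[l..] : T$.
   Context: Simply-typed $\lambda$-calculus with sums over a set $\mathcal{B}$ of base types. Types: $A,B::= b\ (b\in\mathcal{B})\mid \top\mid A\times B\mid A\to B\mid \bot\mid A+B$. Contexts $\Gamma$ are finite lists of typed variables $(x:A)$. Terms: variables, $\star$, pairs $(t,u)$, projections $\pi_1 t,\pi_2 t$, $\lambda x.t$, application $t\,u$, $\mathrm{raise}\,t$, $\mathrm{inl}\,t$, $\mathrm{inr}\,t$, and case analysis $\mathrm{case}\ s\ (x.b_l)\ (x.b_r)$. Typing $\Gamma\vdash t:A$: $x:A$ if $(x:A)\in\Gamma$; $\star:\top$; $(t,u):A\times B$ if $t:A$, $u:B$; $\pi_i p:A_i$ if $p:A_1\times A_2$; $\lambda x.t:A\to B$ if $\Gamma.(x:A)\vdash t:B$; $t\,u:B$ if $t:A\to B$, $u:A$; $\mathrm{raise}\,t:A$ (any $A$) if $t:\bot$; $\mathrm{inl}\,a:A+B$ if $a:A$; $\mathrm{inr}\,b:A+B$ if $b:B$; $\mathrm{case}\ s\ (x.b_l)\ (x.b_r):T$ if $s:A+B$, $\Gamma.(x:A)\vdash b_l:T$,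 $\Gamma.(x:B)\vdash b_r:T$. $r[l..]$ denotes the term obtained by substituting $l$ for the (last) variable $x$ of $r$. Conversion $\Gamma\vdash t\equiv u:A$ is the least typed congruent equivalence relation containing the $\beta$- and $\eta$-laws of every type former ($\top,\times,\to,\bot,+$), i.e. the equational theory of bicartesian closed categories. Polarised vocabulary $A^+,A^-\subseteq\mathcal{B}$ is defined by induction: $b^+=\{b\}$, $b^-=\emptyset$; $\top^p=\bot^p=\emptyset$; $(A+B)^p=(A\times B)^p=A^p\cup B^p$; $(A\to B)^p=A^{\bar p}\cup B^p$, where $\bar +=-$ and $\bar -=+$. For contexts, $(\Gamma.(x:A))^p=\Gamma^p\cup A^p$ and the empty context has empty vocabulary. -}

module Defs where

open import Data.Empty using (⊥)
open import Data.Sum using (_⊎_)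
open import Relation.Binary.PropositionalEquality using (_≡_)

data Ty (B : Set) : Set where
  base : B → Ty B
  `⊤   : Ty B
  _`×_ : Ty B → Ty B → Ty B
  _`→_ : Ty B → Ty B → Ty B
  `⊥   : Ty B
  _`+_ : Ty B → Ty B → Ty B

infixr 7 _`→_
infixr 8 _`+_
infixr 9 _`×_

data Ctx (B : Set) : Set where
  ε   : Ctx B
  _▹_ : Ctx B → Ty B → Ctx B

infixl 5 _▹_

variable
  B : Set
  Γ Δ : Ctx B
  A A₁ A₂ C T : Ty B

data Var {B : Set} : Ctx B → Ty B → Set where
  zero : Var (Γ ▹ A) A
  suc  : Var Γ A → Var (Γ ▹ C) A

-- Intrinsically typed terms: Tm Γ A is the set of t with Γ ⊢ t : A.
-- The language has no constants.
data Tm {B : Set} : Ctx B → Ty B → Set where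
  var   : Var Γ A → Tm Γ A
  ⋆     : Tm Γ `⊤
  pair  : Tm Γ A₁ → Tm Γ A₂ → Tm Γ (A₁ `× A₂)
  π₁    : Tm Γ (A₁ `× A₂) → Tm Γ A₁
  π₂    : Tm Γ (A₁ `× A₂) → Tm Γ A₂
  lam   : Tm (Γ ▹ A) C → Tm Γ (A `→ C)
  app   : Tm Γ (A `→ C) → Tm Γ A → Tm Γ C
  raise : Tm Γ `⊥ → Tm Γ A
  inl   : Tm Γ A₁ → Tm Γ (A₁ `+ A₂)
  inr   : Tm Γ A₂ → Tm Γ (A₁ `+ A₂)
  case  : Tm Γ (A₁ `+ A₂) → Tm (Γ ▹ A₁) T → Tm (Γ ▹ A₂) T → Tm Γ T

Ren : {B : Set} → Ctx B → Ctx B → Set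
Ren Γ Δ = ∀ {A} → Var Δ A → Var Γ A

liftʳ : Ren Γ Δ → Ren (Γ ▹ A) (Δ ▹ A)
liftʳ ρ zero    = zero
liftʳ ρ (suc x) = suc (ρ x)

ren : Ren Γ Δ → Tm Δ A → Tm Γ A
ren ρ (var x)      = var (ρ x)
ren ρ ⋆            = ⋆
ren ρ (pair t u)   = pair (ren ρ t) (ren ρ u)
ren ρ (π₁ t)       = π₁ (ren ρ t)
ren ρ (π₂ t)       = π₂ (ren ρ t)
ren ρ (lam t)      = lam (ren (liftʳ ρ) t)
ren ρ (app t u)    = app (ren ρ t) (ren ρ u)
ren ρ (raise t)    = raise (ren ρ t)
ren ρ (inl t)      = inl (ren ρ t)
ren ρ (inr t)      = inr (ren ρ t)
ren ρ (case s l r) = case (ren ρ s) (ren (liftʳ ρ) l) (ren (liftʳ ρ) r)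

wk : Tm Γ A → Tm (Γ ▹ C) A
wk = ren suc

Sub : {B : Set} → Ctx B → Ctx B → Set
Sub Γ Δ = ∀ {A} → Var Δ A → Tm Γ A

liftˢ : Sub Γ Δ → Sub (Γ ▹ A) (Δ ▹ A)
liftˢ σ zero    = var zero
liftˢ σ (suc x) = wk (σ x)

sub : Sub Γ Δ → Tm Δ A → Tm Γ A
sub σ (var x)      = σ x
sub σ ⋆            = ⋆
sub σ (pair t u)   = pair (sub σ t) (sub σ u)
sub σ (π₁ t)       = π₁ (sub σ t)
sub σ (π₂ t)       = π₂ (sub σ t)
sub σ (lam t)      = lam (sub (liftˢ σ) t)
sub σ (app t u)    = app (sub σ t) (sub σ u)
sub σ (raise t)    = raise (sub σ t)
sub σ (inl t)      = inl (sub σ t)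
sub σ (inr t)      = inr (sub σ t)
sub σ (case s l r) = case (sub σ s) (sub (liftˢ σ) l) (sub (liftˢ σ) r)

εˢ : Sub Γ ε
εˢ ()

idˢ : Sub Γ Γ
idˢ = var

_∷ˢ_ : Sub Γ Δ → Tm Γ A → Sub Γ (Δ ▹ A)
(σ ∷ˢ u) zero    = u
(σ ∷ˢ u) (suc x) = σ x

_[_]₀ : Tm (Δ ▹ A) C → Tm Δ A → Tm Δ C
r [ l ]₀ = sub (idˢ ∷ˢ l) r

-- substitute u (in Γ ▹ A') for the last variable of r, keeping the rest
-- (weakened): used to state the η-laws of ⊥ and +
_[_]↑ : ∀ {A'} → Tm (Γ ▹ A) C → Tm (Γ ▹ A') A → Tm (Γ ▹ A') C
r [ u ]↑ = sub ((λ x → var (suc x)) ∷ˢ u) r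

infix 4 _≈_
data _≈_ {B : Set} {Γ : Ctx B} : {A : Ty B} → Tm Γ A → Tm Γ A → Set where
  ≈-refl  : {t : Tm Γ A} → t ≈ t
  ≈-sym   : {t u : Tm Γ A} → t ≈ u → u ≈ t
  ≈-trans : {t u v : Tm Γ A} → t ≈ u → u ≈ v → t ≈ v
  pair-cong  : {t t' : Tm Γ A₁} {u u' : Tm Γ A₂} → t ≈ t' → u ≈ u' → pair t u ≈ pair t' u'
  π₁-cong    : {t t' : Tm Γ (A₁ `× A₂)} → t ≈ t' → π₁ t ≈ π₁ t'
  π₂-cong    : {t t' : Tm Γ (A₁ `× A₂)} → t ≈ t' → π₂ t ≈ π₂ t'
  lam-cong   : {t t' : Tm (Γ ▹ A) C} → _≈_ {Γ = Γ ▹ A} t t' → lam t ≈ lam t'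
  app-cong   : {t t' : Tm Γ (A `→ C)} {u u' : Tm Γ A} → t ≈ t' → u ≈ u' → app t u ≈ app t' u'
  raise-cong : {t t' : Tm Γ `⊥} → t ≈ t' → raise {A = A} t ≈ raise t'
  inl-cong   : {t t' : Tm Γ A₁} → t ≈ t' → inl {A₂ = A₂} t ≈ inl t'
  inr-cong   : {t t' : Tm Γ A₂} → t ≈ t' → inr {A₁ = A₁} t ≈ inr t'
  case-cong  : {s s' : Tm Γ (A₁ `+ A₂)} {l l' : Tm (Γ ▹ A₁) T} {r r' : Tm (Γ ▹ A₂) T} →
               s ≈ s' → _≈_ {Γ = Γ ▹ A₁} l l' → _≈_ {Γ = Γ ▹ A₂} r r' →
               case s l r ≈ case s' l' r'
  ⊤-η  : (t : Tm Γ `⊤) → t ≈ ⋆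
  ×-β₁ : (t : Tm Γ A₁) (u : Tm Γ A₂) → π₁ (pair t u) ≈ t
  ×-β₂ : (t : Tm Γ A₁) (u : Tm Γ A₂) → π₂ (pair t u) ≈ u
  ×-η  : (t : Tm Γ (A₁ `× A₂)) → t ≈ pair (π₁ t) (π₂ t)
  →-β  : (t : Tm (Γ ▹ A) C) (u : Tm Γ A) → app (lam t) u ≈ t [ u ]₀
  →-η  : (t : Tm Γ (A `→ C)) → t ≈ lam (app (wk t) (var zero))
  ⊥-η  : (s : Tm Γ `⊥) (u : Tm (Γ ▹ `⊥) C) → u [ s ]₀ ≈ raise s
  +-β₁ : (a : Tm Γ A₁) (l : Tm (Γ ▹ A₁) T) (r : Tm (Γ ▹ A₂) T) → case (inl a) l r ≈ l [ a ]₀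
  +-β₂ : (b : Tm Γ A₂) (l : Tm (Γ ▹ A₁) T) (r : Tm (Γ ▹ A₂) T) → case (inr b) l r ≈ r [ b ]₀
  +-η  : (s : Tm Γ (A₁ `+ A₂)) (u : Tm (Γ ▹ (A₁ `+ A₂)) C) →
         u [ s ]₀ ≈ case s (u [ inl (var zero) ]↑) (u [ inr (var zero) ]↑)

data Pol : Set where
  pos neg : Pol

flip : Pol → Pol
flip pos = neg
flip neg = pos

_∈Ty_^_ : B → Ty B → Pol → Set
b ∈Ty base b' ^ pos = b' ≡ b
b ∈Ty base b' ^ neg = ⊥
b ∈Ty `⊤ ^ p = ⊥
b ∈Ty `⊥ ^ p = ⊥
b ∈Ty (A `× A') ^ p = (b ∈Ty A ^ p) ⊎ (b ∈Ty A' ^ p)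
b ∈Ty (A `+ A') ^ p = (b ∈Ty A ^ p) ⊎ (b ∈Ty A' ^ p)
b ∈Ty (A `→ A') ^ p = (b ∈Ty A ^ flip p) ⊎ (b ∈Ty A' ^ p)

_∈Ctx_^_ : B → Ctx B → Pol → Set
b ∈Ctx ε ^ p = ⊥
b ∈Ctx (Γ ▹ A) ^ p = (b ∈Ctx Γ ^ p) ⊎ (b ∈Ty A ^ p)

-- Every term is convertible to a normal form: normalisation by evaluation into
-- a Kripke logical predicate that interprets + and ⊥ by case trees over neutral
-- scrutinees. On normal forms we follow Maehara: split the context as Γ₁ ; Γ₂
-- and build, by induction, a type M whose vocabulary is shared by Γ₁ and by
-- ⋀Γ₂ → T, with l over Γ₁, r over Γ₂ and t ≈ r[l]. A neutral term is handled on
-- the side of its head variable, whose vocabulary contains the term's type; an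
-- application or case analysis whose parts live on different sides exchanges
-- interpolants through a product or an implication. The theorem is the split
-- with Γ₂ empty.

module Submission where

open import Defs
open import Data.Empty using (⊥)
open import Data.Product using (Σ; _×_; _,_; proj₁; proj₂; map₁; map₂)
open import Data.Sum as Sum using (_⊎_; inj₁; inj₂)
open import Data.Unit using (⊤; tt)
open import Relation.Binary.PropositionalEquality using (_≡_; refl; sym; trans; cong; cong₂; subst)

variable
  Θ Γ₁ Γ₂ : Ctx B
  D X Y M N : Ty B
  p : Pol
  b : B

infix 4 _≗ˢ_ _≈ˢ_

_≗ˢ_ : Sub Γ Δ → Sub Γ Δ → Set
_≗ˢ_ {Δ = Δ} σ σ' = ∀ {D} (x : Var Δ D) → σ x ≡ σ' x

_≈ˢ_ : Sub Γ Δ → Sub Γ Δ → Set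
_≈ˢ_ {Δ = Δ} σ σ' = ∀ {D} (x : Var Δ D) → σ x ≈ σ' x

wk₁ : Tm (Γ ▹ A) C → Tm (Γ ▹ D ▹ A) C
wk₁ = ren (liftʳ suc)

cong-case : {s s' : Tm Γ (A₁ `+ A₂)} {l l' : Tm (Γ ▹ A₁) T} {r r' : Tm (Γ ▹ A₂) T} →
  s ≡ s' → l ≡ l' → r ≡ r' → case s l r ≡ case s' l' r'
cong-case refl refl refl = refl

liftˢ-ext : {σ σ' : Sub Γ Δ} → σ ≗ˢ σ' → liftˢ {A = A} σ ≗ˢ liftˢ σ'
liftˢ-ext e zero    = refl
liftˢ-ext e (suc x) = cong wk (e x)

sub-ext : {σ σ' : Sub Γ Δ} → σ ≗ˢ σ' → (t : Tm Δ A) → sub σ t ≡ sub σ' t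
sub-ext e (var x)      = e x
sub-ext e ⋆            = refl
sub-ext e (pair t u)   = cong₂ pair (sub-ext e t) (sub-ext e u)
sub-ext e (π₁ t)       = cong π₁ (sub-ext e t)
sub-ext e (π₂ t)       = cong π₂ (sub-ext e t)
sub-ext e (lam t)      = cong lam (sub-ext (liftˢ-ext e) t)
sub-ext e (app t u)    = cong₂ app (sub-ext e t) (sub-ext e u)
sub-ext e (raise t)    = cong raise (sub-ext e t)
sub-ext e (inl t)      = cong inl (sub-ext e t)
sub-ext e (inr t)      = cong inr (sub-ext e t)
sub-ext e (case s l r) = cong-case (sub-ext e s) (sub-ext (liftˢ-ext e) l) (sub-ext (liftˢ-ext e) r)

liftˢ-id : {σ : Sub Γ Γ} → σ ≗ˢ idˢ → liftˢ {A = A} σ ≗ˢ idˢ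
liftˢ-id e zero    = refl
liftˢ-id e (suc x) = cong wk (e x)

sub-id : {σ : Sub Γ Γ} → σ ≗ˢ idˢ → (t : Tm Γ A) → sub σ t ≡ t
sub-id e (var x)      = e x
sub-id e ⋆            = refl
sub-id e (pair t u)   = cong₂ pair (sub-id e t) (sub-id e u)
sub-id e (π₁ t)       = cong π₁ (sub-id e t)
sub-id e (π₂ t)       = cong π₂ (sub-id e t)
sub-id e (lam t)      = cong lam (sub-id (liftˢ-id e) t)
sub-id e (app t u)    = cong₂ app (sub-id e t) (sub-id e u)
sub-id e (raise t)    = cong raise (sub-id e t)
sub-id e (inl t)      = cong inl (sub-id e t)
sub-id e (inr t)      = cong inr (sub-id e t)
sub-id e (case s l r) = cong-case (sub-id e s) (sub-id (liftˢ-id e) l) (sub-id (liftˢ-id e) r)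

liftˢ-liftʳ : (σ : Sub Γ Δ) (ρ : Ren Δ Θ) →
  (λ {D} (x : Var (Θ ▹ A) D) → liftˢ σ (liftʳ ρ x)) ≗ˢ liftˢ (λ x → σ (ρ x))
liftˢ-liftʳ σ ρ zero    = refl
liftˢ-liftʳ σ ρ (suc x) = refl

sub-ren : (σ : Sub Γ Δ) (ρ : Ren Δ Θ) (t : Tm Θ A) → sub σ (ren ρ t) ≡ sub (λ x → σ (ρ x)) t
sub-ren σ ρ (var x)      = refl
sub-ren σ ρ ⋆            = refl
sub-ren σ ρ (pair t u)   = cong₂ pair (sub-ren σ ρ t) (sub-ren σ ρ u)
sub-ren σ ρ (π₁ t)       = cong π₁ (sub-ren σ ρ t)
sub-ren σ ρ (π₂ t)       = cong π₂ (sub-ren σ ρ t)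
sub-ren σ ρ (lam t)      = cong lam (trans (sub-ren (liftˢ σ) (liftʳ ρ) t) (sub-ext (liftˢ-liftʳ σ ρ) t))
sub-ren σ ρ (app t u)    = cong₂ app (sub-ren σ ρ t) (sub-ren σ ρ u)
sub-ren σ ρ (raise t)    = cong raise (sub-ren σ ρ t)
sub-ren σ ρ (inl t)      = cong inl (sub-ren σ ρ t)
sub-ren σ ρ (inr t)      = cong inr (sub-ren σ ρ t)
sub-ren σ ρ (case s l r) = cong-case (sub-ren σ ρ s)
  (trans (sub-ren (liftˢ σ) (liftʳ ρ) l) (sub-ext (liftˢ-liftʳ σ ρ) l))
  (trans (sub-ren (liftˢ σ) (liftʳ ρ) r) (sub-ext (liftˢ-liftʳ σ ρ) r))

ren-as-sub : (ρ : Ren Γ Δ) (t : Tm Δ A) → ren ρ t ≡ sub (λ x → var (ρ x)) t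
ren-as-sub ρ t = trans (sym (sub-id (λ x → refl) (ren ρ t))) (sub-ren var ρ t)

ren-ext : {ρ ρ' : Ren Γ Δ} → (∀ {D} (x : Var Δ D) → ρ x ≡ ρ' x) → (t : Tm Δ A) → ren ρ t ≡ ren ρ' t
ren-ext {ρ = ρ} {ρ'} e t =
  trans (ren-as-sub ρ t) (trans (sub-ext (λ x → cong var (e x)) t) (sym (ren-as-sub ρ' t)))

ren-id : {ρ : Ren Γ Γ} → (∀ {D} (x : Var Γ D) → ρ x ≡ x) → (t : Tm Γ A) → ren ρ t ≡ t
ren-id {ρ = ρ} e t = trans (ren-as-sub ρ t) (sub-id (λ x → cong var (e x)) t)

ren-ren : (ρ : Ren Γ Δ) (ρ' : Ren Δ Θ) (t : Tm Θ A) → ren ρ (ren ρ' t) ≡ ren (λ x → ρ (ρ' x)) t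
ren-ren ρ ρ' t =
  trans (ren-as-sub ρ (ren ρ' t)) (trans (sub-ren _ ρ' t) (sym (ren-as-sub (λ x → ρ (ρ' x)) t)))

wk-ren : (ρ : Ren Γ Δ) (t : Tm Δ A) → ren (liftʳ {A = C} ρ) (wk t) ≡ wk (ren ρ t)
wk-ren ρ t = trans (ren-ren (liftʳ ρ) suc t) (sym (ren-ren suc ρ t))

liftʳ-liftˢ : (ρ : Ren Γ Δ) (σ : Sub Δ Θ) →
  (λ {D} (x : Var (Θ ▹ A) D) → ren (liftʳ ρ) (liftˢ σ x)) ≗ˢ liftˢ (λ x → ren ρ (σ x))
liftʳ-liftˢ ρ σ zero    = refl
liftʳ-liftˢ ρ σ (suc x) = wk-ren ρ (σ x)

ren-sub : (ρ : Ren Γ Δ) (σ : Sub Δ Θ) (t : Tm Θ A) → ren ρ (sub σ t) ≡ sub (λ x → ren ρ (σ x)) t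
ren-sub ρ σ (var x)      = refl
ren-sub ρ σ ⋆            = refl
ren-sub ρ σ (pair t u)   = cong₂ pair (ren-sub ρ σ t) (ren-sub ρ σ u)
ren-sub ρ σ (π₁ t)       = cong π₁ (ren-sub ρ σ t)
ren-sub ρ σ (π₂ t)       = cong π₂ (ren-sub ρ σ t)
ren-sub ρ σ (lam t)      = cong lam (trans (ren-sub (liftʳ ρ) (liftˢ σ) t) (sub-ext (liftʳ-liftˢ ρ σ) t))
ren-sub ρ σ (app t u)    = cong₂ app (ren-sub ρ σ t) (ren-sub ρ σ u)
ren-sub ρ σ (raise t)    = cong raise (ren-sub ρ σ t)
ren-sub ρ σ (inl t)      = cong inl (ren-sub ρ σ t)
ren-sub ρ σ (inr t)      = cong inr (ren-sub ρ σ t)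
ren-sub ρ σ (case s l r) = cong-case (ren-sub ρ σ s)
  (trans (ren-sub (liftʳ ρ) (liftˢ σ) l) (sub-ext (liftʳ-liftˢ ρ σ) l))
  (trans (ren-sub (liftʳ ρ) (liftˢ σ) r) (sub-ext (liftʳ-liftˢ ρ σ) r))

wk-sub : (σ : Sub Γ Δ) (t : Tm Δ A) → sub (liftˢ {A = C} σ) (wk t) ≡ wk (sub σ t)
wk-sub σ t = trans (sub-ren (liftˢ σ) suc t) (sym (ren-sub suc σ t))

liftˢ-liftˢ : (σ : Sub Γ Δ) (τ : Sub Δ Θ) →
  (λ {D} (x : Var (Θ ▹ A) D) → sub (liftˢ σ) (liftˢ τ x)) ≗ˢ liftˢ (λ x → sub σ (τ x))
liftˢ-liftˢ σ τ zero    = refl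
liftˢ-liftˢ σ τ (suc x) = wk-sub σ (τ x)

sub-sub : (σ : Sub Γ Δ) (τ : Sub Δ Θ) (t : Tm Θ A) → sub σ (sub τ t) ≡ sub (λ x → sub σ (τ x)) t
sub-sub σ τ (var x)      = refl
sub-sub σ τ ⋆            = refl
sub-sub σ τ (pair t u)   = cong₂ pair (sub-sub σ τ t) (sub-sub σ τ u)
sub-sub σ τ (π₁ t)       = cong π₁ (sub-sub σ τ t)
sub-sub σ τ (π₂ t)       = cong π₂ (sub-sub σ τ t)
sub-sub σ τ (lam t)      = cong lam (trans (sub-sub (liftˢ σ) (liftˢ τ) t) (sub-ext (liftˢ-liftˢ σ τ) t))
sub-sub σ τ (app t u)    = cong₂ app (sub-sub σ τ t) (sub-sub σ τ u)
sub-sub σ τ (raise t)    = cong raise (sub-sub σ τ t)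
sub-sub σ τ (inl t)      = cong inl (sub-sub σ τ t)
sub-sub σ τ (inr t)      = cong inr (sub-sub σ τ t)
sub-sub σ τ (case s l r) = cong-case (sub-sub σ τ s)
  (trans (sub-sub (liftˢ σ) (liftˢ τ) l) (sub-ext (liftˢ-liftˢ σ τ) l))
  (trans (sub-sub (liftˢ σ) (liftˢ τ) r) (sub-ext (liftˢ-liftˢ σ τ) r))

wk-[]₀ : (t : Tm Γ A) (u : Tm Γ C) → wk t [ u ]₀ ≡ t
wk-[]₀ t u = trans (sub-ren _ suc t) (sub-id (λ x → refl) t)

liftˢ-[]₀ : (σ : Sub Γ Δ) (a : Tm Γ A) (t : Tm (Δ ▹ A) C) → sub (liftˢ σ) t [ a ]₀ ≡ sub (σ ∷ˢ a) t
liftˢ-[]₀ σ a t = trans (sub-sub _ _ t) (sub-ext (λ { zero → refl ; (suc x) → wk-[]₀ (σ x) a }) t)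

ren-liftˢ : (ρ : Ren Γ Δ) (σ : Sub Δ Θ) (t : Tm (Θ ▹ A) C) →
  ren (liftʳ ρ) (sub (liftˢ σ) t) ≡ sub (liftˢ (λ x → ren ρ (σ x))) t
ren-liftˢ ρ σ t = trans (ren-sub (liftʳ ρ) (liftˢ σ) t) (sub-ext (liftʳ-liftˢ ρ σ) t)

ren-[]₀ : (ρ : Ren Γ Δ) (t : Tm (Δ ▹ A) C) (u : Tm Δ A) → ren ρ (t [ u ]₀) ≡ ren (liftʳ ρ) t [ ren ρ u ]₀
ren-[]₀ ρ t u =
  trans (ren-sub ρ _ t) (trans (sub-ext (λ { zero → refl ; (suc x) → refl }) t) (sym (sub-ren _ (liftʳ ρ) t)))

ren-[]↑ : (ρ : Ren Γ Δ) (t : Tm (Δ ▹ A) C) (u : Tm (Δ ▹ D) A) →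
  ren (liftʳ ρ) (t [ u ]↑) ≡ ren (liftʳ ρ) t [ ren (liftʳ ρ) u ]↑
ren-[]↑ ρ t u =
  trans (ren-sub (liftʳ ρ) _ t) (trans (sub-ext (λ { zero → refl ; (suc x) → refl }) t) (sym (sub-ren _ (liftʳ ρ) t)))

wk₁-ren : (ρ : Ren Γ Δ) (t : Tm (Δ ▹ A) C) → ren (liftʳ (liftʳ {A = D} ρ)) (wk₁ t) ≡ wk₁ (ren (liftʳ ρ) t)
wk₁-ren ρ t = trans (ren-ren _ _ t) (trans (ren-ext (λ { zero → refl ; (suc x) → refl }) t) (sym (ren-ren _ _ t)))

∷ˢ-wk₁ : (σ : Sub Δ (Γ ▹ X)) (w : Tm Δ A) (t : Tm (Γ ▹ A) C) →
  sub (σ ∷ˢ w) (wk₁ t) ≡ sub ((λ x → σ (suc x)) ∷ˢ w) t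
∷ˢ-wk₁ σ w t = trans (sub-ren _ _ t) (sub-ext (λ { zero → refl ; (suc x) → refl }) t)

liftˢ-∷ˢ-wk₁ : (σ : Sub Γ Δ) (v : Tm Γ X) (t : Tm (Δ ▹ A) C) →
  sub (liftˢ (σ ∷ˢ v)) (wk₁ t) ≡ sub (liftˢ σ) t
liftˢ-∷ˢ-wk₁ σ v t = trans (sub-ren _ _ t) (sub-ext (λ { zero → refl ; (suc x) → refl }) t)

sub-wk₁-[]₀ : (σ : Sub Δ Γ) (v : Tm Δ X) (t : Tm (Γ ▹ A) C) (w : Tm (Γ ▹ X) A) →
  sub (σ ∷ˢ v) (wk₁ t [ w ]₀) ≡ sub (σ ∷ˢ sub (σ ∷ˢ v) w) t
sub-wk₁-[]₀ σ v t w =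
  trans (sub-sub _ _ (wk₁ t)) (trans (sub-ren _ _ t) (sub-ext (λ { zero → refl ; (suc x) → refl }) t))

liftˢ-wk-[var₀] : (t : Tm (Γ ▹ A) C) → sub (liftˢ (λ x → var (suc {C = A} x))) t [ var zero ]₀ ≡ t
liftˢ-wk-[var₀] t = trans (sub-sub _ _ t) (sub-id (λ { zero → refl ; (suc x) → refl }) t)

liftʳ-wk-[]₀ : (ρ : Ren Δ Γ) (u : Tm Γ A) (s : Tm Δ D) → ren (liftʳ ρ) (wk u) [ s ]₀ ≡ ren ρ u
liftʳ-wk-[]₀ ρ u s = trans (cong (λ f → f [ s ]₀) (wk-ren ρ u)) (wk-[]₀ (ren ρ u) s)

ren-liftˢ-[]₀ : (ρ : Ren Δ Γ) (σ : Sub Γ Θ) (a : Tm Δ A) (t : Tm (Θ ▹ A) C) →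
  ren (liftʳ ρ) (sub (liftˢ σ) t) [ a ]₀ ≡ sub ((λ x → ren ρ (σ x)) ∷ˢ a) t
ren-liftˢ-[]₀ ρ σ a t = trans (cong (λ f → f [ a ]₀) (ren-liftˢ ρ σ t)) (liftˢ-[]₀ _ a t)

liftˢ-var : (ρ : Ren Γ Δ) (t : Tm (Δ ▹ A) C) → sub (liftˢ (λ x → var (ρ x))) t ≡ ren (liftʳ ρ) t
liftˢ-var ρ t = trans (sub-ext (λ { zero → refl ; (suc x) → refl }) t) (sym (ren-as-sub (liftʳ ρ) t))

≡⇒≈ : {t u : Tm Γ A} → t ≡ u → t ≈ u
≡⇒≈ refl = ≈-refl

infixr 2 _≈⟨_⟩_ _≡⟨_⟩_
infix  3 _∎

_≈⟨_⟩_ : (t : Tm Γ A) {u v : Tm Γ A} → t ≈ u → u ≈ v → t ≈ v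
t ≈⟨ p ⟩ q = ≈-trans p q

_≡⟨_⟩_ : (t : Tm Γ A) {u v : Tm Γ A} → t ≡ u → u ≈ v → t ≈ v
t ≡⟨ p ⟩ q = ≈-trans (≡⇒≈ p) q

_∎ : (t : Tm Γ A) → t ≈ t
t ∎ = ≈-refl

ren-≈ : (ρ : Ren Γ Δ) {t u : Tm Δ A} → t ≈ u → ren ρ t ≈ ren ρ u
ren-≈ ρ ≈-refl            = ≈-refl
ren-≈ ρ (≈-sym p)         = ≈-sym (ren-≈ ρ p)
ren-≈ ρ (≈-trans p q)     = ≈-trans (ren-≈ ρ p) (ren-≈ ρ q)
ren-≈ ρ (pair-cong p q)   = pair-cong (ren-≈ ρ p) (ren-≈ ρ q)
ren-≈ ρ (π₁-cong p)       = π₁-cong (ren-≈ ρ p)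
ren-≈ ρ (π₂-cong p)       = π₂-cong (ren-≈ ρ p)
ren-≈ ρ (lam-cong p)      = lam-cong (ren-≈ (liftʳ ρ) p)
ren-≈ ρ (app-cong p q)    = app-cong (ren-≈ ρ p) (ren-≈ ρ q)
ren-≈ ρ (raise-cong p)    = raise-cong (ren-≈ ρ p)
ren-≈ ρ (inl-cong p)      = inl-cong (ren-≈ ρ p)
ren-≈ ρ (inr-cong p)      = inr-cong (ren-≈ ρ p)
ren-≈ ρ (case-cong p q r) = case-cong (ren-≈ ρ p) (ren-≈ (liftʳ ρ) q) (ren-≈ (liftʳ ρ) r)
ren-≈ ρ (⊤-η t)           = ⊤-η _
ren-≈ ρ (×-β₁ t u)        = ×-β₁ _ _
ren-≈ ρ (×-β₂ t u)        = ×-β₂ _ _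
ren-≈ ρ (×-η t)           = ×-η _
ren-≈ ρ (→-β t u)         = ≈-trans (→-β _ _) (≡⇒≈ (sym (ren-[]₀ ρ t u)))
ren-≈ ρ (→-η t)           = ≈-trans (→-η _) (≡⇒≈ (cong (λ f → lam (app f (var zero))) (sym (wk-ren ρ t))))
ren-≈ ρ (⊥-η s u)         = ≈-trans (≡⇒≈ (ren-[]₀ ρ u s)) (⊥-η _ (ren (liftʳ ρ) u))
ren-≈ ρ (+-β₁ a l r)      = ≈-trans (+-β₁ _ _ _) (≡⇒≈ (sym (ren-[]₀ ρ l a)))
ren-≈ ρ (+-β₂ b l r)      = ≈-trans (+-β₂ _ _ _) (≡⇒≈ (sym (ren-[]₀ ρ r b)))
ren-≈ ρ (+-η s u)         = ≈-trans (≡⇒≈ (ren-[]₀ ρ u s))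
  (≈-trans (+-η _ (ren (liftʳ ρ) u)) (≡⇒≈ (cong-case refl (sym (ren-[]↑ ρ u _)) (sym (ren-[]↑ ρ u _)))))

liftˢ-≈ : {σ σ' : Sub Γ Δ} → σ ≈ˢ σ' → liftˢ {A = A} σ ≈ˢ liftˢ σ'
liftˢ-≈ e zero    = ≈-refl
liftˢ-≈ e (suc x) = ren-≈ suc (e x)

sub-≈ : {σ σ' : Sub Γ Δ} → σ ≈ˢ σ' → (t : Tm Δ A) → sub σ t ≈ sub σ' t
sub-≈ e (var x)      = e x
sub-≈ e ⋆            = ≈-refl
sub-≈ e (pair t u)   = pair-cong (sub-≈ e t) (sub-≈ e u)
sub-≈ e (π₁ t)       = π₁-cong (sub-≈ e t)
sub-≈ e (π₂ t)       = π₂-cong (sub-≈ e t)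
sub-≈ e (lam t)      = lam-cong (sub-≈ (liftˢ-≈ e) t)
sub-≈ e (app t u)    = app-cong (sub-≈ e t) (sub-≈ e u)
sub-≈ e (raise t)    = raise-cong (sub-≈ e t)
sub-≈ e (inl t)      = inl-cong (sub-≈ e t)
sub-≈ e (inr t)      = inr-cong (sub-≈ e t)
sub-≈ e (case s l r) = case-cong (sub-≈ e s) (sub-≈ (liftˢ-≈ e) l) (sub-≈ (liftˢ-≈ e) r)

sub-[]↑ : (σ : Sub Γ Δ) (v : Tm Γ D) (w : Tm Γ M) (r : Tm (Δ ▹ M) T) (u : Tm (Δ ▹ D) M) →
  sub (σ ∷ˢ v) u ≈ w → sub (σ ∷ˢ v) (r [ u ]↑) ≈ sub (σ ∷ˢ w) r
sub-[]↑ σ v w r u e = ≈-trans (≡⇒≈ (sub-sub _ _ r)) (sub-≈ (λ { zero → e ; (suc x) → ≈-refl }) r)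

caseFrame : Tm (Γ ▹ A₁) T → Tm (Γ ▹ A₂) T → Tm (Γ ▹ (A₁ `+ A₂)) T
caseFrame l r = case (var zero) (wk₁ l) (wk₁ r)

sub-caseFrame : (σ : Sub Δ Γ) (v : Tm Δ (A₁ `+ A₂)) (l : Tm (Γ ▹ A₁) T) (r : Tm (Γ ▹ A₂) T) →
  sub (σ ∷ˢ v) (caseFrame l r) ≡ case v (sub (liftˢ σ) l) (sub (liftˢ σ) r)
sub-caseFrame σ v l r = cong-case refl (liftˢ-∷ˢ-wk₁ σ v l) (liftˢ-∷ˢ-wk₁ σ v r)

caseFrame-[]₀ : (l : Tm (Γ ▹ A₁) T) (r : Tm (Γ ▹ A₂) T) (s : Tm Γ (A₁ `+ A₂)) →
  caseFrame l r [ s ]₀ ≡ case s l r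
caseFrame-[]₀ l r s = trans (sub-caseFrame idˢ s l r) (cong-case refl (liftˢ-idˢ l) (liftˢ-idˢ r))
  where
  liftˢ-idˢ : (t : Tm (Γ ▹ D) T) → sub (liftˢ idˢ) t ≡ t
  liftˢ-idˢ = sub-id (liftˢ-id (λ x → refl))

ren-caseFrame-[]₀ : (ρ : Ren Δ Γ) (l : Tm (Γ ▹ A₁) T) (r : Tm (Γ ▹ A₂) T) (s : Tm Δ (A₁ `+ A₂)) →
  ren (liftʳ ρ) (caseFrame l r) [ s ]₀ ≡ case s (ren (liftʳ ρ) l) (ren (liftʳ ρ) r)
ren-caseFrame-[]₀ ρ l r s = trans (cong (λ f → f [ s ]₀) ren-caseFrame) (caseFrame-[]₀ _ _ s)
  where
  ren-caseFrame : ren (liftʳ ρ) (caseFrame l r) ≡ caseFrame (ren (liftʳ ρ) l) (ren (liftʳ ρ) r)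
  ren-caseFrame = cong-case refl (wk₁-ren ρ l) (wk₁-ren ρ r)

-- A commuting conversion, from +-η applied to the frame E [ case • t₁ t₂ ]₀.
plug-case : (E : Tm (Γ ▹ A) C) (s : Tm Γ (A₁ `+ A₂)) (t₁ : Tm (Γ ▹ A₁) A) (t₂ : Tm (Γ ▹ A₂) A) →
  E [ case s t₁ t₂ ]₀ ≈ case s (wk₁ E [ t₁ ]₀) (wk₁ E [ t₂ ]₀)
plug-case {Γ = Γ} {A = A} {A₁ = A₁} {A₂ = A₂} E s t₁ t₂ =
  E [ case s t₁ t₂ ]₀
    ≡⟨ sym (trans (sub-wk₁-[]₀ idˢ s E F) (cong (λ f → E [ f ]₀) (caseFrame-[]₀ t₁ t₂ s))) ⟩
  u [ s ]₀
    ≈⟨ +-η s u ⟩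
  case s (u [ inl (var zero) ]↑) (u [ inr (var zero) ]↑)
    ≈⟨ case-cong ≈-refl (β-branch t₁ inlFrame) (β-branch t₂ inrFrame) ⟩
  case s (wk₁ E [ t₁ ]₀) (wk₁ E [ t₂ ]₀) ∎
  where
  F = caseFrame t₁ t₂
  u = wk₁ E [ F ]₀
  inlFrame : sub ((λ x → var (suc x)) ∷ˢ inl (var zero)) F ≈ t₁
  inlFrame = ≈-trans (≡⇒≈ (sub-caseFrame _ _ t₁ t₂)) (≈-trans (+-β₁ _ _ _) (≡⇒≈ (liftˢ-wk-[var₀] t₁)))
  inrFrame : sub ((λ x → var (suc x)) ∷ˢ inr (var zero)) F ≈ t₂
  inrFrame = ≈-trans (≡⇒≈ (sub-caseFrame _ _ t₁ t₂)) (≈-trans (+-β₂ _ _ _) (≡⇒≈ (liftˢ-wk-[var₀] t₂)))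
  β-branch : ∀ {X} (t : Tm (Γ ▹ X) A) {w : Tm (Γ ▹ X) (A₁ `+ A₂)} →
    sub ((λ x → var (suc x)) ∷ˢ w) F ≈ t → u [ w ]↑ ≈ wk₁ E [ t ]₀
  β-branch t {w} e = ≈-trans (≡⇒≈ (sub-wk₁-[]₀ _ w E F))
    (≈-trans (sub-≈ (λ { zero → e ; (suc x) → ≈-refl }) E) (≡⇒≈ (sym (∷ˢ-wk₁ idˢ t E))))

plug-raise : (E : Tm (Γ ▹ A) C) (s : Tm Γ `⊥) → E [ raise s ]₀ ≈ raise s
plug-raise E s = ≈-trans (≡⇒≈ (sym (sub-wk₁-[]₀ idˢ s E (raise (var zero))))) (⊥-η s (wk₁ E [ raise (var zero) ]₀))

case-case : (s : Tm Γ (A₁ `+ A₂)) (a : Tm (Γ ▹ A₁) (X `+ Y)) (b : Tm (Γ ▹ A₂) (X `+ Y))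
  (l : Tm (Γ ▹ X) C) (r : Tm (Γ ▹ Y) C) →
  case (case s a b) l r ≈ case s (case a (wk₁ l) (wk₁ r)) (case b (wk₁ l) (wk₁ r))
case-case s a b l r =
  case (case s a b) l r
    ≡⟨ sym (caseFrame-[]₀ l r (case s a b)) ⟩
  caseFrame l r [ case s a b ]₀
    ≈⟨ plug-case (caseFrame l r) s a b ⟩
  case s (wk₁ (caseFrame l r) [ a ]₀) (wk₁ (caseFrame l r) [ b ]₀)
    ≡⟨ cong-case refl (ren-caseFrame-[]₀ suc l r a) (ren-caseFrame-[]₀ suc l r b) ⟩
  case s (case a (wk₁ l) (wk₁ r)) (case b (wk₁ l) (wk₁ r)) ∎

data Ne {B : Set} : {Γ : Ctx B} {A : Ty B} → Tm Γ A → Set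
data Nf {B : Set} : {Γ : Ctx B} {A : Ty B} → Tm Γ A → Set

data Ne {B} where
  var : (x : Var Γ A) → Ne (var x)
  π₁  : {t : Tm Γ (A₁ `× A₂)} → Ne t → Ne (π₁ t)
  π₂  : {t : Tm Γ (A₁ `× A₂)} → Ne t → Ne (π₂ t)
  app : {t : Tm Γ (A `→ C)} {u : Tm Γ A} → Ne t → Nf u → Ne (app t u)

data Nf {B} where
  ne    : {t : Tm Γ A} → Ne t → Nf t
  ⋆     : Nf {Γ = Γ} ⋆
  pair  : {t : Tm Γ A₁} {u : Tm Γ A₂} → Nf t → Nf u → Nf (pair t u)
  lam   : {t : Tm (Γ ▹ A) C} → Nf t → Nf (lam t)
  inl   : {t : Tm Γ A₁} → Nf t → Nf (inl {A₂ = A₂} t)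
  inr   : {t : Tm Γ A₂} → Nf t → Nf (inr {A₁ = A₁} t)
  case  : {s : Tm Γ (A₁ `+ A₂)} {l : Tm (Γ ▹ A₁) T} {r : Tm (Γ ▹ A₂) T} →
          Ne s → Nf l → Nf r → Nf (case s l r)
  raise : {s : Tm Γ `⊥} → Ne s → Nf (raise {A = A} s)

Ne-ren : (ρ : Ren Γ Δ) {t : Tm Δ A} → Ne t → Ne (ren ρ t)
Nf-ren : (ρ : Ren Γ Δ) {t : Tm Δ A} → Nf t → Nf (ren ρ t)
Ne-ren ρ (var x)      = var (ρ x)
Ne-ren ρ (π₁ n)       = π₁ (Ne-ren ρ n)
Ne-ren ρ (π₂ n)       = π₂ (Ne-ren ρ n)
Ne-ren ρ (app n v)    = app (Ne-ren ρ n) (Nf-ren ρ v)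
Nf-ren ρ (ne n)       = ne (Ne-ren ρ n)
Nf-ren ρ ⋆            = ⋆
Nf-ren ρ (pair v w)   = pair (Nf-ren ρ v) (Nf-ren ρ w)
Nf-ren ρ (lam v)      = lam (Nf-ren (liftʳ ρ) v)
Nf-ren ρ (inl v)      = inl (Nf-ren ρ v)
Nf-ren ρ (inr v)      = inr (Nf-ren ρ v)
Nf-ren ρ (case n v w) = case (Ne-ren ρ n) (Nf-ren (liftʳ ρ) v) (Nf-ren (liftʳ ρ) w)
Nf-ren ρ (raise n)    = raise (Ne-ren ρ n)

HasNf : Tm Γ A → Set
HasNf t = Σ _ λ t' → Nf t' × (t ≈ t')

-- A neutral of sum or empty type has no canonical form; its semantics is a
-- case tree over neutral scrutinees, with leaves in Q.
data Cover {B : Set} {A : Ty B} (Q : ∀ {Δ : Ctx B} → Tm Δ A → Set) : {Γ : Ctx B} → Tm Γ A → Set where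
  leaf   : {t : Tm Γ A} → Q t → Cover Q t
  branch : {t : Tm Γ A} {s : Tm Γ (X `+ Y)} {t₁ : Tm (Γ ▹ X) A} {t₂ : Tm (Γ ▹ Y) A} →
           Ne s → Cover Q t₁ → Cover Q t₂ → t ≈ case s t₁ t₂ → Cover Q t
  abort  : {t : Tm Γ A} {s : Tm Γ `⊥} → Ne s → t ≈ raise s → Cover Q t

Sem    : (A : Ty B) {Γ : Ctx B} → Tm Γ A → Set
SemInj : (A C : Ty B) {Γ : Ctx B} → Tm Γ (A `+ C) → Set
Sem (base b)  t = HasNf t
Sem `⊤        t = ⊤
Sem (A `× C)  t = Sem A (π₁ t) × Sem C (π₂ t)
Sem (A `→ C) {Γ} t = ∀ {Δ} (ρ : Ren Δ Γ) {u : Tm Δ A} → Sem A u → Sem C (app (ren ρ t) u)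
Sem `⊥        t = Cover (λ _ → ⊥) t
Sem (A `+ C)  t = Cover (SemInj A C) t

SemInj A C s = (Σ _ λ a → (s ≈ inl a) × Sem A a) ⊎ (Σ _ λ c → (s ≈ inr c) × Sem C c)

Cover-≈ : {Q : ∀ {Δ} → Tm Δ A → Set} → (∀ {Δ} {t u : Tm Δ A} → t ≈ u → Q t → Q u) →
  {t u : Tm Γ A} → t ≈ u → Cover Q t → Cover Q u
Cover-≈ Q-≈ e (leaf q)           = leaf (Q-≈ e q)
Cover-≈ Q-≈ e (branch n c₁ c₂ p) = branch n c₁ c₂ (≈-trans (≈-sym e) p)
Cover-≈ Q-≈ e (abort n p)        = abort n (≈-trans (≈-sym e) p)

Cover-ren : {Q : ∀ {Δ} → Tm Δ A → Set} → (∀ {Δ Δ'} (ρ : Ren Δ' Δ) {t : Tm Δ A} → Q t → Q (ren ρ t)) →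
  (ρ : Ren Δ Γ) {t : Tm Γ A} → Cover Q t → Cover Q (ren ρ t)
Cover-ren Q-ren ρ (leaf q)           = leaf (Q-ren ρ q)
Cover-ren Q-ren ρ (branch n c₁ c₂ p) =
  branch (Ne-ren ρ n) (Cover-ren Q-ren (liftʳ ρ) c₁) (Cover-ren Q-ren (liftʳ ρ) c₂) (ren-≈ ρ p)
Cover-ren Q-ren ρ (abort n p)        = abort (Ne-ren ρ n) (ren-≈ ρ p)

Sem-≈ : (A : Ty B) {t u : Tm Γ A} → t ≈ u → Sem A t → Sem A u
Sem-≈ (base b) e (t' , v , p) = t' , v , ≈-trans (≈-sym e) p
Sem-≈ `⊤       e tt           = tt
Sem-≈ (A `× C) e (p , q)      = Sem-≈ A (π₁-cong e) p , Sem-≈ C (π₂-cong e) q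
Sem-≈ (A `→ C) e f ρ pu       = Sem-≈ C (app-cong (ren-≈ ρ e) ≈-refl) (f ρ pu)
Sem-≈ `⊥       e c            = Cover-≈ (λ _ ()) e c
Sem-≈ (A `+ C) e c            = Cover-≈
  (λ { e' (inj₁ (a , p , q)) → inj₁ (a , ≈-trans (≈-sym e') p , q)
     ; e' (inj₂ (a , p , q)) → inj₂ (a , ≈-trans (≈-sym e') p , q) }) e c

Sem-ren : (A : Ty B) (ρ : Ren Δ Γ) {t : Tm Γ A} → Sem A t → Sem A (ren ρ t)
Sem-ren (base b) ρ (t' , v , p) = ren ρ t' , Nf-ren ρ v , ren-≈ ρ p
Sem-ren `⊤       ρ tt           = tt
Sem-ren (A `× C) ρ (p , q)      = Sem-ren A ρ p , Sem-ren C ρ q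
Sem-ren (A `→ C) ρ {t} f ρ' pu  =
  subst (Sem C) (cong (λ g → app g _) (sym (ren-ren ρ' ρ t))) (f (λ x → ρ' (ρ x)) pu)
Sem-ren `⊥       ρ c            = Cover-ren (λ _ ()) ρ c
Sem-ren (A `+ C) ρ c            = Cover-ren
  (λ { ρ' (inj₁ (a , p , q)) → inj₁ (ren ρ' a , ren-≈ ρ' p , Sem-ren A ρ' q)
     ; ρ' (inj₂ (a , p , q)) → inj₂ (ren ρ' a , ren-≈ ρ' p , Sem-ren C ρ' q) }) ρ c

Cover-plug : {Q : ∀ {Δ} → Tm Δ A → Set} {Q' : ∀ {Δ} → Tm Δ C → Set} (E : Tm (Γ ▹ A) C) →
  (∀ {Δ} (ρ : Ren Δ Γ) {t : Tm Δ A} → Q t → Q' (ren (liftʳ ρ) E [ t ]₀)) →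
  (ρ : Ren Δ Γ) {t : Tm Δ A} → Cover Q t → Cover Q' (ren (liftʳ ρ) E [ t ]₀)
Cover-plug E K ρ (leaf q) = leaf (K ρ q)
Cover-plug {Q = Q} {Q'} E K ρ (branch {s = s} {t₁} {t₂} n c₁ c₂ p) =
  branch n (Cover-plug {Q = Q} {Q'} E K (λ x → suc (ρ x)) c₁) (Cover-plug {Q = Q} {Q'} E K (λ x → suc (ρ x)) c₂)
    (≈-trans (sub-≈ (λ { zero → p ; (suc x) → ≈-refl }) (ren (liftʳ ρ) E))
    (≈-trans (plug-case (ren (liftʳ ρ) E) s t₁ t₂)
             (≡⇒≈ (cong-case refl (cong (λ f → f [ t₁ ]₀) wk₁-E) (cong (λ f → f [ t₂ ]₀) wk₁-E)))))
  where
  wk₁-E : ∀ {X} → wk₁ {D = X} (ren (liftʳ ρ) E) ≡ ren (liftʳ (λ x → suc (ρ x))) E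
  wk₁-E = trans (ren-ren _ _ E) (ren-ext (λ { zero → refl ; (suc x) → refl }) E)
Cover-plug E K ρ (abort {s = s} n p) =
  abort n (≈-trans (sub-≈ {σ' = idˢ ∷ˢ raise s} (λ { zero → p ; (suc x) → ≈-refl }) (ren (liftʳ ρ) E))
                   (plug-raise (ren (liftʳ ρ) E) s))

Cover-plug₀ : {Q : ∀ {Δ} → Tm Δ A → Set} {Q' : ∀ {Δ} → Tm Δ C → Set} (E : Tm (Γ ▹ A) C) →
  (∀ {Δ} (ρ : Ren Δ Γ) {t : Tm Δ A} → Q t → Q' (ren (liftʳ ρ) E [ t ]₀)) →
  {t : Tm Γ A} → Cover Q t → Cover Q' (E [ t ]₀)
Cover-plug₀ {Q' = Q'} E K {t} c = subst (λ F → Cover Q' (F [ t ]₀)) (ren-id liftʳ-id E) (Cover-plug E K (λ x → x) c)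
  where
  liftʳ-id : ∀ {D} (x : Var (_ ▹ _) D) → liftʳ (λ y → y) x ≡ x
  liftʳ-id zero    = refl
  liftʳ-id (suc x) = refl

Cover-join : {Q : ∀ {Δ} → Tm Δ A → Set} {t : Tm Γ A} → Cover (Cover Q) t → Cover Q t
Cover-join (leaf c)           = c
Cover-join (branch n c₁ c₂ p) = branch n (Cover-join c₁) (Cover-join c₂) p
Cover-join (abort n p)        = abort n p

Cover-nf : {Q : ∀ {Δ} → Tm Δ A → Set} → (∀ {Δ} {t : Tm Δ A} → Q t → HasNf t) →
  {t : Tm Γ A} → Cover Q t → HasNf t
Cover-nf K (leaf q) = K q
Cover-nf K (branch n c₁ c₂ p) with Cover-nf K c₁ | Cover-nf K c₂
... | t₁ , v₁ , e₁ | t₂ , v₂ , e₂ = case _ t₁ t₂ , case n v₁ v₂ , ≈-trans p (case-cong ≈-refl e₁ e₂)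
Cover-nf K (abort n p) = raise _ , raise n , p

reflect : (A : Ty B) {t : Tm Γ A} → Ne t → Sem A t
reify   : (A : Ty B) {t : Tm Γ A} → Sem A t → HasNf t
reflect (base b) n = _ , ne n , ≈-refl
reflect `⊤       n = tt
reflect (A `× C) n = reflect A (π₁ n) , reflect C (π₂ n)
reflect (A `→ C) n ρ pu with reify A pu
... | u' , v , e = Sem-≈ C (app-cong ≈-refl (≈-sym e)) (reflect C (app (Ne-ren ρ n) v))
reflect `⊥ {t} n = abort n (⊥-η t (var zero))
reflect (A `+ C) {t} n =
  branch n (leaf (inj₁ (var zero , ≈-refl , reflect A (var zero))))
           (leaf (inj₂ (var zero , ≈-refl , reflect C (var zero))))
           (+-η t (var zero))
reify (base b) p = p
reify `⊤ {t} tt = ⋆ , ⋆ , ⊤-η t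
reify (A `× C) {t} (p , q) with reify A p | reify C q
... | a , v , e | c , w , f = pair a c , pair v w , ≈-trans (×-η t) (pair-cong e f)
reify (A `→ C) {t} f with reify C (f suc (reflect A (var zero)))
... | c , v , e = lam c , lam v , ≈-trans (→-η t) (lam-cong e)
reify `⊥ c = Cover-nf (λ ()) c
reify (A `+ C) c = Cover-nf
  (λ { (inj₁ (a , e , pa)) → let (a' , v , e') = reify A pa in inl a' , inl v , ≈-trans e (inl-cong e')
     ; (inj₂ (c , e , pc)) → let (c' , v , e') = reify C pc in inr c' , inr v , ≈-trans e (inr-cong e') }) c

Sem-cover : (A : Ty B) {t : Tm Γ A} → Cover (Sem A) t → Sem A t
Sem-cover (base b) c = Cover-nf (λ p → p) c
Sem-cover `⊤       c = tt
Sem-cover (A `× C) c = Sem-cover A (Cover-plug₀ (π₁ (var zero)) (λ ρ → proj₁) c)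
                     , Sem-cover C (Cover-plug₀ (π₂ (var zero)) (λ ρ → proj₂) c)
Sem-cover (A `→ C) {t} c ρ {u} pu =
  subst (Sem C) (cong (app (ren ρ t)) (wk-[]₀ u _))
    (Sem-cover C (Cover-plug₀ (app (var zero) (wk u)) apply (Cover-ren (Sem-ren (A `→ C)) ρ c)))
  where
  apply : ∀ {Δ'} (ρ' : Ren Δ' _) {f : Tm Δ' (A `→ C)} → Sem (A `→ C) f →
    Sem C (ren (liftʳ ρ') (app (var zero) (wk u)) [ f ]₀)
  apply ρ' {f} sf = subst (Sem C) (cong₂ app (ren-id (λ x → refl) f) (sym (liftʳ-wk-[]₀ ρ' u f)))
                                  (sf (λ x → x) (Sem-ren A ρ' pu))
Sem-cover `⊥       c = Cover-join c
Sem-cover (A `+ C) c = Cover-join c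

SemSub : Sub Γ Θ → Set
SemSub {Θ = Θ} σ = ∀ {D} (x : Var Θ D) → Sem D (σ x)

SemSub-∷ : (ρ : Ren Δ Γ) {σ : Sub Γ Θ} → SemSub σ → {a : Tm Δ A} → Sem A a →
  SemSub ((λ x → ren ρ (σ x)) ∷ˢ a)
SemSub-∷ ρ η sa zero    = sa
SemSub-∷ ρ η sa (suc x) = Sem-ren _ ρ (η x)

fundamental : (t : Tm Θ A) (σ : Sub Γ Θ) → SemSub σ → Sem A (sub σ t)
fundamental (var x) σ η = η x
fundamental ⋆ σ η = tt
fundamental {A = A₁ `× A₂} (pair t u) σ η =
  Sem-≈ A₁ (≈-sym (×-β₁ _ _)) (fundamental t σ η) , Sem-≈ A₂ (≈-sym (×-β₂ _ _)) (fundamental u σ η)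
fundamental (π₁ t) σ η = proj₁ (fundamental t σ η)
fundamental (π₂ t) σ η = proj₂ (fundamental t σ η)
fundamental {A = A `→ C} (lam t) σ η ρ {u} pu =
  Sem-≈ C (≈-sym (≈-trans (→-β _ u) (≡⇒≈ (ren-liftˢ-[]₀ ρ σ u t)))) (fundamental t _ (SemSub-∷ ρ η pu))
fundamental {A = C} (app t u) σ η =
  subst (Sem C) (cong (λ f → app f (sub σ u)) (ren-id (λ x → refl) (sub σ t)))
    (fundamental t σ η (λ x → x) (fundamental u σ η))
fundamental {A = A} (raise t) σ η = Sem-cover A (Cover-plug₀ (raise (var zero)) (λ ρ ()) (fundamental t σ η))
fundamental (inl t) σ η = leaf (inj₁ (_ , ≈-refl , fundamental t σ η))
fundamental (inr t) σ η = leaf (inj₂ (_ , ≈-refl , fundamental t σ η))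
fundamental {A = T} (case s l r) σ η =
  subst (Sem T) (caseFrame-[]₀ L R (sub σ s)) (Sem-cover T (Cover-plug₀ (caseFrame L R) branches (fundamental s σ η)))
  where
  L = sub (liftˢ σ) l
  R = sub (liftˢ σ) r
  branches : ∀ {Δ} (ρ : Ren Δ _) {s' : Tm Δ _} → SemInj _ _ s' → Sem T (ren (liftʳ ρ) (caseFrame L R) [ s' ]₀)
  branches ρ {s'} (inj₁ (a , e , sa)) = subst (Sem T) (sym (ren-caseFrame-[]₀ ρ L R s'))
    (Sem-≈ T (≈-sym (≈-trans (case-cong e ≈-refl ≈-refl) (≈-trans (+-β₁ _ _ _) (≡⇒≈ (ren-liftˢ-[]₀ ρ σ a l)))))
      (fundamental l _ (SemSub-∷ ρ η sa)))
  branches ρ {s'} (inj₂ (a , e , sa)) = subst (Sem T) (sym (ren-caseFrame-[]₀ ρ L R s'))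
    (Sem-≈ T (≈-sym (≈-trans (case-cong e ≈-refl ≈-refl) (≈-trans (+-β₂ _ _ _) (≡⇒≈ (ren-liftˢ-[]₀ ρ σ a r)))))
      (fundamental r _ (SemSub-∷ ρ η sa)))

normalise : (t : Tm Γ A) → HasNf t
normalise {A = A} t = reify A (subst (Sem A) (sub-id (λ x → refl) t) (fundamental t var (λ x → reflect _ (var x))))

data Split {B : Set} : Ctx B → Ctx B → Ctx B → Set where
  ε     : Split ε ε ε
  left  : Split Γ Γ₁ Γ₂ → Split (Γ ▹ A) (Γ₁ ▹ A) Γ₂
  right : Split Γ Γ₁ Γ₂ → Split (Γ ▹ A) Γ₁ (Γ₂ ▹ A)

swap : Split Γ Γ₁ Γ₂ → Split Γ Γ₂ Γ₁
swap ε         = ε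
swap (left P)  = right (swap P)
swap (right P) = left (swap P)

allLeft : (Γ : Ctx B) → Split Γ Γ ε
allLeft ε       = ε
allLeft (Γ ▹ A) = left (allLeft Γ)

ιˡ : Split Γ Γ₁ Γ₂ → Ren Γ Γ₁
ιˡ (left P)  = liftʳ (ιˡ P)
ιˡ (right P) = λ x → suc (ιˡ P x)

ιʳ : Split Γ Γ₁ Γ₂ → Ren Γ Γ₂
ιʳ (left P)  = λ x → suc (ιʳ P x)
ιʳ (right P) = liftʳ (ιʳ P)

ιˡ-swap : (P : Split Γ Γ₁ Γ₂) (x : Var Γ₂ A) → ιˡ (swap P) x ≡ ιʳ P x
ιˡ-swap (left P)  x       = cong suc (ιˡ-swap P x)
ιˡ-swap (right P) zero    = refl
ιˡ-swap (right P) (suc x) = cong suc (ιˡ-swap P x)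

ιʳ-swap : (P : Split Γ Γ₁ Γ₂) (x : Var Γ₁ A) → ιʳ (swap P) x ≡ ιˡ P x
ιʳ-swap (left P)  zero    = refl
ιʳ-swap (left P)  (suc x) = cong suc (ιʳ-swap P x)
ιʳ-swap (right P) x       = cong suc (ιʳ-swap P x)

ιˡ-allLeft : (Γ : Ctx B) (x : Var Γ A) → ιˡ (allLeft Γ) x ≡ x
ιˡ-allLeft (Γ ▹ A) zero    = refl
ιˡ-allLeft (Γ ▹ A) (suc x) = cong suc (ιˡ-allLeft Γ x)

data Origin (P : Split Γ Γ₁ Γ₂) (x : Var Γ A) : Set where
  fromˡ : (y : Var Γ₁ A) → ιˡ P y ≡ x → Origin P x
  fromʳ : (y : Var Γ₂ A) → ιʳ P y ≡ x → Origin P x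

origin : (P : Split Γ Γ₁ Γ₂) (x : Var Γ A) → Origin P x
origin (left P)  zero = fromˡ zero refl
origin (right P) zero = fromʳ zero refl
origin (left P)  (suc x) with origin P x
... | fromˡ y e = fromˡ (suc y) (cong suc e)
... | fromʳ y e = fromʳ y (cong suc e)
origin (right P) (suc x) with origin P x
... | fromˡ y e = fromˡ y (cong suc e)
... | fromʳ y e = fromʳ (suc y) (cong suc e)

∈Ty-flip-flip : b ∈Ty A ^ p → b ∈Ty A ^ flip (flip p)
∈Ty-flip-flip {p = pos} h = h
∈Ty-flip-flip {p = neg} h = h

∈Ctx-flip-flip : b ∈Ctx Γ ^ flip (flip p) → b ∈Ctx Γ ^ p
∈Ctx-flip-flip {p = pos} h = h
∈Ctx-flip-flip {p = neg} h = h

_⊑_ : Ty B → Ctx B → Set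
A ⊑ Γ = ∀ {p b} → b ∈Ty A ^ p → b ∈Ctx Γ ^ p

var-⊑ : Var Γ A → A ⊑ Γ
var-⊑ zero    h = inj₂ h
var-⊑ (suc x) h = inj₁ (var-⊑ x h)

-- the vocabulary of the formula ⋀Δ → T
_∈Seq_⊢_^_ : B → Ctx B → Ty B → Pol → Set
b ∈Seq Δ ⊢ T ^ p = (b ∈Ctx Δ ^ flip p) ⊎ (b ∈Ty T ^ p)

∈Ctx-▹-⊑ : A ⊑ Γ → ∀ {p b} → b ∈Ctx Γ ▹ A ^ p → b ∈Ctx Γ ^ p
∈Ctx-▹-⊑ A⊑Γ (inj₁ h) = h
∈Ctx-▹-⊑ A⊑Γ (inj₂ h) = A⊑Γ h

∈Seq-▹-⊑ : A ⊑ Δ → ∀ {p b} → b ∈Seq Δ ▹ A ⊢ T ^ p → b ∈Seq Δ ⊢ T ^ p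
∈Seq-▹-⊑ A⊑Δ (inj₁ h) = inj₁ (∈Ctx-▹-⊑ A⊑Δ h)
∈Seq-▹-⊑ A⊑Δ (inj₂ h) = inj₂ h

joinˡ : Split Γ Γ₁ Γ₂ → Tm Γ₁ M → Sub Γ (Γ₂ ▹ M)
joinˡ P l = (λ x → var (ιʳ P x)) ∷ˢ ren (ιˡ P) l

joinʳ : Split Γ Γ₁ Γ₂ → Tm Γ₂ M → Sub Γ (Γ₁ ▹ M)
joinʳ P l = (λ x → var (ιˡ P x)) ∷ˢ ren (ιʳ P) l

joinˡ-swap : (P : Split Γ Γ₁ Γ₂) (l : Tm Γ₂ M) (t : Tm (Γ₁ ▹ M) A) →
  sub (joinˡ (swap P) l) t ≡ sub (joinʳ P l) t
joinˡ-swap P l = sub-ext λ { zero → ren-ext (ιˡ-swap P) l ; (suc x) → cong var (ιʳ-swap P x) }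

joinʳ-swap : (P : Split Γ Γ₁ Γ₂) (l : Tm Γ₁ M) (t : Tm (Γ₂ ▹ M) A) →
  sub (joinʳ (swap P) l) t ≡ sub (joinˡ P l) t
joinʳ-swap P l = sub-ext λ { zero → ren-ext (ιʳ-swap P) l ; (suc x) → cong var (ιˡ-swap P x) }

record Interpolant (P : Split Γ Γ₁ Γ₂) {T : Ty B} (t : Tm Γ T) : Set where
  constructor interpolant
  field
    ty     : Ty B
    l      : Tm Γ₁ ty
    r      : Tm (Γ₂ ▹ ty) T
    shared : ∀ {p b} → b ∈Ty ty ^ p → (b ∈Ctx Γ₁ ^ p) × (b ∈Seq Γ₂ ⊢ T ^ p)
    conv   : t ≈ sub (joinˡ P l) r

-- For a neutral term whose head variable lies in Γ₁ the interpolant flows the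
-- other way, from Γ₂ into the spine; the type of the term is then part of Γ₁.
record NeInterpolant (P : Split Γ Γ₁ Γ₂) {A : Ty B} (n : Tm Γ A) : Set where
  constructor neInterpolant
  field
    ty     : Ty B
    l      : Tm Γ₂ ty
    a      : Tm (Γ₁ ▹ ty) A
    shared : ∀ {p b} → b ∈Ty ty ^ p → (b ∈Ctx Γ₂ ^ p) × (b ∈Ctx Γ₁ ^ flip p)
    typed  : A ⊑ Γ₁
    conv   : n ≈ sub (joinʳ P l) a

Interpolant-≈ : {P : Split Γ Γ₁ Γ₂} {t u : Tm Γ T} → t ≈ u → Interpolant P u → Interpolant P t
Interpolant-≈ e (interpolant M l r sh c) = interpolant M l r sh (≈-trans e c)

joinˡ-lam-app : (P : Split Γ Γ₁ Γ₂) (l : Tm Γ₂ N) (a : Tm (Γ₁ ▹ N) A) →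
  sub (joinˡ P (lam a)) (app (var zero) (wk l)) ≈ sub (joinʳ P l) a
joinˡ-lam-app P l a =
  app (ren (ιˡ P) (lam a)) (sub (joinˡ P (lam a)) (wk l))
    ≡⟨ cong (app _) (trans (sub-ren _ suc l) (sym (ren-as-sub (ιʳ P) l))) ⟩
  app (lam (ren (liftʳ (ιˡ P)) a)) (ren (ιʳ P) l)
    ≈⟨ →-β _ _ ⟩
  ren (liftʳ (ιˡ P)) a [ ren (ιʳ P) l ]₀
    ≡⟨ trans (sub-ren _ _ a) (sub-ext (λ { zero → refl ; (suc x) → refl }) a) ⟩
  sub (joinʳ P l) a ∎

exchangeˢ : Tm (Γ ▹ X) M → Sub (Γ ▹ X ▹ A) (Γ ▹ A ▹ M)
exchangeˢ w zero          = wk w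
exchangeˢ w (suc zero)    = var zero
exchangeˢ w (suc (suc x)) = var (suc (suc x))

sub-exchangeˢ : (σ : Sub Δ (Γ ▹ X)) (w : Tm (Γ ▹ X) M) (r : Tm (Γ ▹ A ▹ M) C) →
  sub (liftˢ σ) (sub (exchangeˢ w) r) ≡ sub (liftˢ (λ x → σ (suc x)) ∷ˢ wk (sub σ w)) r
sub-exchangeˢ σ w r =
  trans (sub-sub _ _ r) (sub-ext (λ { zero → wk-sub σ w ; (suc zero) → refl ; (suc (suc x)) → refl }) r)

joinˡ-right : (P : Split Γ Γ₁ Γ₂) (l : Tm Γ₁ M) {w : Tm (Γ ▹ A) M} (r : Tm (Γ₂ ▹ A ▹ M) C) →
  w ≈ wk (ren (ιˡ P) l) → sub (liftˢ (λ x → var (ιʳ P x)) ∷ˢ w) r ≈ sub (joinˡ (right P) l) r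
joinˡ-right P l r e = sub-≈ (λ { zero → ≈-trans e (≡⇒≈ (ren-ren suc (ιˡ P) l))
                              ; (suc zero) → ≈-refl ; (suc (suc x)) → ≈-refl }) r

shared-flip : (∀ {p b} → b ∈Ty N ^ p → (b ∈Ctx Γ₂ ^ p) × (b ∈Ctx Γ₁ ^ flip p)) →
  b ∈Ty N ^ flip p → (b ∈Ctx Γ₁ ^ p) × (b ∈Ctx Γ₂ ^ flip p)
shared-flip sh h = let g₂ , g₁ = sh h in ∈Ctx-flip-flip g₁ , g₂

NeInterpolant-var : (P : Split Γ Γ₁ Γ₂) (x : Var Γ A) → NeInterpolant P (var x) ⊎ NeInterpolant (swap P) (var x)
NeInterpolant-var P x with origin P x
... | fromˡ y refl = inj₁ (neInterpolant `⊤ ⋆ (var (suc y)) (λ ()) (var-⊑ y) ≈-refl)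
... | fromʳ y refl = inj₂ (neInterpolant `⊤ ⋆ (var (suc y)) (λ ()) (var-⊑ y) (≡⇒≈ (cong var (sym (ιˡ-swap P y)))))

NeInterpolant-π₁ : {P : Split Γ Γ₁ Γ₂} {n : Tm Γ (A₁ `× A₂)} → NeInterpolant P n → NeInterpolant P (π₁ n)
NeInterpolant-π₁ (neInterpolant N l a sh ty c) = neInterpolant N l (π₁ a) sh (λ h → ty (inj₁ h)) (π₁-cong c)

NeInterpolant-π₂ : {P : Split Γ Γ₁ Γ₂} {n : Tm Γ (A₁ `× A₂)} → NeInterpolant P n → NeInterpolant P (π₂ n)
NeInterpolant-π₂ (neInterpolant N l a sh ty c) = neInterpolant N l (π₂ a) sh (λ h → ty (inj₂ h)) (π₂-cong c)

NeInterpolant-app : (P : Split Γ Γ₁ Γ₂) {n : Tm Γ (A `→ C)} {u : Tm Γ A} →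
  NeInterpolant P n → Interpolant (swap P) u → NeInterpolant P (app n u)
NeInterpolant-app {A = A} P (neInterpolant N lₙ aₙ shₙ tyₙ cₙ) (interpolant M lᵤ rᵤ shᵤ cᵤ) =
  neInterpolant (N `× M) (pair lₙ lᵤ) (app (aₙ [ π₁ (var zero) ]↑) (rᵤ [ π₂ (var zero) ]↑))
    sh (λ h → tyₙ (inj₂ h)) conv
  where
  sh : ∀ {p b} → b ∈Ty N `× M ^ p → _
  sh (inj₁ h) = shₙ h
  sh (inj₂ h) with shᵤ h
  ... | g₂ , inj₁ g₁ = g₂ , g₁
  ... | g₂ , inj₂ hA = g₂ , tyₙ (inj₁ (∈Ty-flip-flip hA))
  conv = ≈-trans (app-cong cₙ (≈-trans cᵤ (≡⇒≈ (joinˡ-swap P lᵤ rᵤ))))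
           (≈-sym (app-cong (sub-[]↑ _ _ _ aₙ _ (×-β₁ _ _)) (sub-[]↑ _ _ _ rᵤ _ (×-β₂ _ _))))

Interpolant-neˡ : (P : Split Γ Γ₁ Γ₂) {n : Tm Γ T} → NeInterpolant P n → Interpolant P n
Interpolant-neˡ {T = T} P (neInterpolant N l a sh ty c) =
  interpolant (N `→ T) (lam a) (app (var zero) (wk l)) sh' (≈-trans c (≈-sym (joinˡ-lam-app P l a)))
  where
  sh' : ∀ {p b} → b ∈Ty N `→ T ^ p → _
  sh' (inj₁ h) = map₂ inj₁ (shared-flip sh h)
  sh' (inj₂ h) = ty h , inj₂ h

Interpolant-neʳ : (P : Split Γ Γ₁ Γ₂) {n : Tm Γ T} → NeInterpolant (swap P) n → Interpolant P n
Interpolant-neʳ P (neInterpolant N l a sh _ c) =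
  interpolant N l a (λ h → map₂ inj₁ (sh h)) (≈-trans c (≡⇒≈ (joinʳ-swap P l a)))

Interpolant-⋆ : {P : Split Γ Γ₁ Γ₂} → Interpolant P ⋆
Interpolant-⋆ = interpolant `⊤ ⋆ ⋆ (λ ()) ≈-refl

Interpolant-pair : {P : Split Γ Γ₁ Γ₂} {t : Tm Γ A₁} {u : Tm Γ A₂} →
  Interpolant P t → Interpolant P u → Interpolant P (pair t u)
Interpolant-pair (interpolant M₁ l₁ r₁ sh₁ c₁) (interpolant M₂ l₂ r₂ sh₂ c₂) =
  interpolant (M₁ `× M₂) (pair l₁ l₂) (pair (r₁ [ π₁ (var zero) ]↑) (r₂ [ π₂ (var zero) ]↑)) sh
    (≈-trans (pair-cong c₁ c₂) (≈-sym (pair-cong (sub-[]↑ _ _ _ r₁ _ (×-β₁ _ _)) (sub-[]↑ _ _ _ r₂ _ (×-β₂ _ _)))))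
  where
  sh : ∀ {p b} → b ∈Ty M₁ `× M₂ ^ p → _
  sh (inj₁ h) = map₂ (Sum.map₂ inj₁) (sh₁ h)
  sh (inj₂ h) = map₂ (Sum.map₂ inj₂) (sh₂ h)

Interpolant-lam : (P : Split Γ Γ₁ Γ₂) {t : Tm (Γ ▹ A) C} → Interpolant (right P) t → Interpolant P (lam t)
Interpolant-lam P (interpolant M l r sh c) =
  interpolant M l (lam (sub (exchangeˢ (var zero)) r)) (λ h → map₂ ∈Seq-lam (sh h))
    (lam-cong (≈-trans c (≈-sym (≈-trans (≡⇒≈ (sub-exchangeˢ _ (var zero) r)) (joinˡ-right P l r ≈-refl)))))
  where
  ∈Seq-lam : ∀ {p b} → b ∈Seq Γ₂ ▹ A ⊢ C ^ p → b ∈Seq Γ₂ ⊢ A `→ C ^ p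
  ∈Seq-lam (inj₁ (inj₁ g)) = inj₁ g
  ∈Seq-lam (inj₁ (inj₂ h)) = inj₂ (inj₁ h)
  ∈Seq-lam (inj₂ h)        = inj₂ (inj₂ h)

Interpolant-inl : {P : Split Γ Γ₁ Γ₂} {t : Tm Γ A₁} → Interpolant P t → Interpolant P (inl {A₂ = A₂} t)
Interpolant-inl (interpolant M l r sh c) = interpolant M l (inl r) (λ h → map₂ (Sum.map₂ inj₁) (sh h)) (inl-cong c)

Interpolant-inr : {P : Split Γ Γ₁ Γ₂} {t : Tm Γ A₂} → Interpolant P t → Interpolant P (inr {A₁ = A₁} t)
Interpolant-inr (interpolant M l r sh c) = interpolant M l (inr r) (λ h → map₂ (Sum.map₂ inj₂) (sh h)) (inr-cong c)

Interpolant-raise : {P : Split Γ Γ₁ Γ₂} {t : Tm Γ `⊥} → Interpolant P t → Interpolant P (raise {A = A} t)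
Interpolant-raise (interpolant M l r sh c) = interpolant M l (raise r) (λ h → map₂ (Sum.map₂ λ ()) (sh h)) (raise-cong c)

-- The scrutinee's interpolant N comes from Γ₂; the Γ₁ side turns it into the
-- choice of a branch together with that branch's interpolant.
Interpolant-caseˡ : (P : Split Γ Γ₁ Γ₂) {s : Tm Γ (A₁ `+ A₂)} {t₁ : Tm (Γ ▹ A₁) T} {t₂ : Tm (Γ ▹ A₂) T} →
  NeInterpolant P s → Interpolant (left P) t₁ → Interpolant (left P) t₂ → Interpolant P (case s t₁ t₂)
Interpolant-caseˡ {T = T} P {s} {t₁} {t₂}
  (neInterpolant N l a sh ty c) (interpolant M₁ l₁ r₁ sh₁ c₁) (interpolant M₂ l₂ r₂ sh₂ c₂) =
  interpolant (N `→ (M₁ `+ M₂)) (lam body) (case (app (var zero) (wk l)) (wk₁ r₁) (wk₁ r₂)) sh' (≈-sym conv)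
  where
  body = case a (inl (wk₁ l₁)) (inr (wk₁ l₂))
  σ = joinˡ P (lam body)
  τ = joinʳ P l
  sh' : ∀ {p b} → b ∈Ty N `→ (M₁ `+ M₂) ^ p → _
  sh' (inj₁ h)        = map₂ inj₁ (shared-flip sh h)
  sh' (inj₂ (inj₁ h)) = map₁ (∈Ctx-▹-⊑ (λ h' → ty (inj₁ h'))) (sh₁ h)
  sh' (inj₂ (inj₂ h)) = map₁ (∈Ctx-▹-⊑ (λ h' → ty (inj₂ h'))) (sh₂ h)
  reassemble : ∀ {X M} (l₀ : Tm (_ ▹ X) M) (r₀ : Tm (_ ▹ M) T) →
    wk₁ (sub (liftˢ σ) (wk₁ r₀)) [ sub (liftˢ τ) (wk₁ l₀) ]₀ ≡ sub (joinˡ (left P) l₀) r₀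
  reassemble l₀ r₀ = trans (cong₂ (λ f x → wk₁ f [ x ]₀) (liftˢ-∷ˢ-wk₁ _ _ r₀)
                                                    (trans (liftˢ-∷ˢ-wk₁ _ _ l₀) (liftˢ-var (ιˡ P) l₀)))
                       (ren-liftˢ-[]₀ suc _ _ r₀)
  conv : sub σ (case (app (var zero) (wk l)) (wk₁ r₁) (wk₁ r₂)) ≈ case s t₁ t₂
  conv =
    case (sub σ (app (var zero) (wk l))) (sub (liftˢ σ) (wk₁ r₁)) (sub (liftˢ σ) (wk₁ r₂))
      ≈⟨ case-cong (joinˡ-lam-app P l body) ≈-refl ≈-refl ⟩
    case (sub τ body) (sub (liftˢ σ) (wk₁ r₁)) (sub (liftˢ σ) (wk₁ r₂))
      ≈⟨ case-case _ _ _ _ _ ⟩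
    case (sub τ a) (case (inl (sub (liftˢ τ) (wk₁ l₁))) _ _) (case (inr (sub (liftˢ τ) (wk₁ l₂))) _ _)
      ≈⟨ case-cong (≈-sym c) (≈-trans (+-β₁ _ _ _) (≈-trans (≡⇒≈ (reassemble l₁ r₁)) (≈-sym c₁)))
                             (≈-trans (+-β₂ _ _ _) (≈-trans (≡⇒≈ (reassemble l₂ r₂)) (≈-sym c₂))) ⟩
    case s t₁ t₂ ∎

-- Here the scrutinee's interpolant N comes from Γ₁ and the branches are
-- decided on the Γ₂ side, so all three interpolants are handed over at once.
Interpolant-caseʳ : (P : Split Γ Γ₁ Γ₂) {s : Tm Γ (A₁ `+ A₂)} {t₁ : Tm (Γ ▹ A₁) T} {t₂ : Tm (Γ ▹ A₂) T} →
  NeInterpolant (swap P) s → Interpolant (right P) t₁ → Interpolant (right P) t₂ → Interpolant P (case s t₁ t₂)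
Interpolant-caseʳ P {s} {t₁} {t₂}
  (neInterpolant N l a sh ty c) (interpolant M₁ l₁ r₁ sh₁ c₁) (interpolant M₂ l₂ r₂ sh₂ c₂) =
  interpolant (N `× (M₁ `× M₂)) (pair l (pair l₁ l₂))
    (case (a [ π₁ (var zero) ]↑) (sub (exchangeˢ (π₁ (π₂ (var zero)))) r₁) (sub (exchangeˢ (π₂ (π₂ (var zero)))) r₂))
    sh' conv
  where
  sh' : ∀ {p b} → b ∈Ty N `× (M₁ `× M₂) ^ p → _
  sh' (inj₁ h)        = map₂ inj₁ (sh h)
  sh' (inj₂ (inj₁ h)) = map₂ (∈Seq-▹-⊑ (λ h' → ty (inj₁ h'))) (sh₁ h)
  sh' (inj₂ (inj₂ h)) = map₂ (∈Seq-▹-⊑ (λ h' → ty (inj₂ h'))) (sh₂ h)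
  σ = joinˡ P (pair l (pair l₁ l₂))
  conv = case-cong (≈-trans (≈-trans c (≡⇒≈ (joinʳ-swap P l a))) (≈-sym (sub-[]↑ _ _ _ a _ (×-β₁ _ _))))
    (≈-trans c₁ (≈-sym (≈-trans (≡⇒≈ (sub-exchangeˢ σ _ r₁))
      (joinˡ-right P l₁ r₁ (ren-≈ suc (≈-trans (π₁-cong (×-β₂ _ _)) (×-β₁ _ _)))))))
    (≈-trans c₂ (≈-sym (≈-trans (≡⇒≈ (sub-exchangeˢ σ _ r₂))
      (joinˡ-right P l₂ r₂ (ren-≈ suc (≈-trans (π₂-cong (×-β₂ _ _)) (×-β₂ _ _)))))))

neInterpolation : (P : Split Γ Γ₁ Γ₂) {n : Tm Γ A} → Ne n → NeInterpolant P n ⊎ NeInterpolant (swap P) n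
nfInterpolation : (P : Split Γ Γ₁ Γ₂) {t : Tm Γ T} → Nf t → Interpolant P t

neInterpolation P (var x)   = NeInterpolant-var P x
neInterpolation P (π₁ n)    = Sum.map NeInterpolant-π₁ NeInterpolant-π₁ (neInterpolation P n)
neInterpolation P (π₂ n)    = Sum.map NeInterpolant-π₂ NeInterpolant-π₂ (neInterpolation P n)
neInterpolation P (app n v) with neInterpolation P n
... | inj₁ i = inj₁ (NeInterpolant-app P i (nfInterpolation (swap P) v))
... | inj₂ i = inj₂ (NeInterpolant-app (swap P) i (nfInterpolation (swap (swap P)) v))

nfInterpolation P (ne n)       = Sum.[ Interpolant-neˡ P , Interpolant-neʳ P ] (neInterpolation P n)
nfInterpolation P ⋆            = Interpolant-⋆
nfInterpolation P (pair v w)   = Interpolant-pair (nfInterpolation P v) (nfInterpolation P w)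
nfInterpolation P (lam v)      = Interpolant-lam P (nfInterpolation (right P) v)
nfInterpolation P (inl v)      = Interpolant-inl (nfInterpolation P v)
nfInterpolation P (inr v)      = Interpolant-inr (nfInterpolation P v)
nfInterpolation P (raise n)    = Interpolant-raise (nfInterpolation P (ne n))
nfInterpolation P (case n v w) with neInterpolation P n
... | inj₁ i = Interpolant-caseˡ P i (nfInterpolation (left P) v) (nfInterpolation (left P) w)
... | inj₂ i = Interpolant-caseʳ P i (nfInterpolation (right P) v) (nfInterpolation (right P) w)

interpolation : (P : Split Γ Γ₁ Γ₂) (t : Tm Γ T) → Interpolant P t
interpolation P t = let t' , v , e = normalise t in Interpolant-≈ e (nfInterpolation P v)

mainTheorem1 : {B : Set} {Γ : Ctx B} {T : Ty B} (t : Tm Γ T) →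
    Σ (Ty B) λ M → Σ (Tm Γ M) λ l → Σ (Tm (ε ▹ M) T) λ r →
      ((p : Pol) (b : B) → b ∈Ty M ^ p → (b ∈Ctx Γ ^ p) × (b ∈Ty T ^ p))
      × (t ≈ sub (εˢ ∷ˢ l) r)
mainTheorem1 {Γ = Γ} {T} t with interpolation (allLeft Γ) t
... | interpolant M l r sh c =
  M , l , r , (λ p b h → map₂ onlyType (sh h)) ,
  ≈-trans c (≡⇒≈ (sub-ext (λ { zero → ren-id (ιˡ-allLeft Γ) l ; (suc ()) }) r))
  where
  onlyType : b ∈Seq ε ⊢ T ^ p → b ∈Ty T ^ p
  onlyType (inj₂ h) = h
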